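{- Let $g(x),f(x)$ be formal power series with integer coefficients and $g(0)=f(0)=1$, let $A=(g(x),xf(x))$ with entries $a_{n,k}=[x^n]g(x)(xf(x))^k$, and let $\phi(x)$ be the reversion of $x/f(x)$. Let $c(A;2)$ be the lower-triangular matrix with $(n,k)$ entry $a_{2n+1,n+k+1}$ ($n,k\ge0$). Then $c(A;2)$ is a Riordan array and $$c(A;2)=(\phi'(x),\phi(x))\cdot A.$$
   Context: A Riordan array $(d(x),h(x))$, for formal power series $d,h$ with $d(0)\neq 0$, $h(0)=0$, $h'(0)\neq 0$, is the infinite lower-triangular matrix whose $(n,k)$ entry is $[x^n]d(x)h(x)^k$. Riordan arrays form a group under matrix multiplication, with $(d,h)\cdot(u,w)=(d(x)u(h(x)),w(h(x)))$. The reversion of a power series $h$ with $h(0)=0$, $h'(0)\ne0$ is the power series $u$ with $u(0)=0$ and $h(u(x))=x$. $\phi'$ denotes the derivative of $\phi$. -}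

module Defs where

open import Data.Nat using (ℕ; zero; suc; _∸_) renaming (_+_ to _+ℕ_; _*_ to _*ℕ_)
open import Data.Integer using (ℤ; +_; _+_; _*_; 0ℤ; 1ℤ)
open import Data.Product using (Σ; _×_)
open import Relation.Binary.PropositionalEquality using (_≡_; _≢_)

Series : Set
Series = ℕ → ℤ

-- Infinite matrices with integer entries, indexed (row n, column k).
Matrix : Set
Matrix = ℕ → ℕ → ℤ

sumTo : ℕ → (ℕ → ℤ) → ℤ
sumTo zero    t = t 0
sumTo (suc n) t = sumTo n t + t (suc n)

one : Series
one zero    = 1ℤ
one (suc _) = 0ℤ

X : Series
X 1 = 1ℤ
X _ = 0ℤ

_⊛_ : Series → Series → Series
(a ⊛ b) n = sumTo n (λ i → a i * b (n ∸ i))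

infixl 7 _⊛_

pow : Series → ℕ → Series
pow a zero    = one
pow a (suc k) = a ⊛ pow a k

-- composition a(b(x)) (meaningful when b(0) = 0): [x^n] = Σ_{k≤n} a_k [x^n] b^k
comp : Series → Series → Series
comp a b n = sumTo n (λ k → a k * pow b k n)

deriv : Series → Series
deriv a n = + (suc n) * a (suc n)

_≈ₛ_ : Series → Series → Set
a ≈ₛ b = ∀ n → a n ≡ b n

riordan : Series → Series → Matrix
riordan d h n k = (d ⊛ pow h k) n

IsRiordanPair : Series → Series → Set
IsRiordanPair d h = (d 0 ≢ 0ℤ) × (h 0 ≡ 0ℤ) × (h 1 ≢ 0ℤ)

IsRiordanArray : Matrix → Set
IsRiordanArray M = Σ Series λ d → Σ Series λ h → IsRiordanPair d h × (∀ n k → M n k ≡ riordan d h n k)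

-- product of lower-triangular infinite matrices: (P Q)_{n,k} = Σ_{j ≤ n} P_{n,j} Q_{j,k}
matMul : Matrix → Matrix → Matrix
matMul P Q n k = sumTo n (λ j → P n j * Q j k)

c2 : Matrix → Matrix
c2 M n k = M (suc (2 *ℕ n)) (suc (n +ℕ k))

module Submission where

-- With ψ = x/f, the chain rule applied to ψ(φ) = x shows that the Riordan array (φ′, φ)
-- is a left inverse of (ψ′, ψ). Differentiating fψ = x gives fψ′ + f′ψ = 1, and together
-- with [x^q] f^q f′ = [x^(q+1)] f^(q+1) this shows that the matrix ([x^(n-j)] f^(n+1))
-- is a left inverse too. As (ψ′, ψ) is unitriangular, the two agree, which is Lagrange
-- inversion in the form [x^n] φ′ b(φ) = [x^n] b f^(n+1). For the k-th column
-- b = g x^k f^k of A this reads [x^n] g x^k f^(n+k+1) = [x^(2n+1)] g (xf)^(n+k+1), the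
-- (n, k) entry of c(A; 2); the fundamental theorem of Riordan arrays then identifies
-- (φ′, φ) · A with (φ′ g(φ), φ f(φ)).

open import Defs
open import Algebra.Bundles using (CommutativeMonoid)
open import Data.Empty using (⊥-elim)
open import Data.Integer using (ℤ; 0ℤ; 1ℤ; +_; _+_; _*_; -_; _-_)
import Data.Integer.Properties as ℤP
open import Algebra.Properties.AbelianGroup ℤP.+-0-abelianGroup using (identityˡ-unique)
open import Data.Integer.Tactic.RingSolver using (solve-∀)
open import Data.Nat using (ℕ; zero; suc; _∸_; _≤_; _<_; z≤n; s≤s) renaming (_+_ to _+ℕ_; _*_ to _*ℕ_)
import Data.Nat.Properties as ℕP
open import Data.Product using (_×_; _,_)
open import Data.Sum using (inj₁; inj₂)
open import Relation.Binary.Definitions using (tri<; tri≈; tri>)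
open import Relation.Binary.PropositionalEquality
open ≡-Reasoning

-- Finite sums

sumTo-cong : ∀ n {t u : ℕ → ℤ} → (∀ i → i ≤ n → t i ≡ u i) → sumTo n t ≡ sumTo n u
sumTo-cong zero    eq = eq 0 z≤n
sumTo-cong (suc n) eq = cong₂ _+_ (sumTo-cong n (λ i i≤n → eq i (ℕP.m≤n⇒m≤1+n i≤n))) (eq (suc n) ℕP.≤-refl)

sumTo-zero : ∀ n {t : ℕ → ℤ} → (∀ i → i ≤ n → t i ≡ 0ℤ) → sumTo n t ≡ 0ℤ
sumTo-zero zero    z = z 0 z≤n
sumTo-zero (suc n) z = cong₂ _+_ (sumTo-zero n (λ i i≤n → z i (ℕP.m≤n⇒m≤1+n i≤n))) (z (suc n) ℕP.≤-refl)

sumTo-+ : ∀ n (t u : ℕ → ℤ) → sumTo n (λ i → t i + u i) ≡ sumTo n t + sumTo n u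
sumTo-+ zero    t u = refl
sumTo-+ (suc n) t u = trans (cong (_+ (t (suc n) + u (suc n))) (sumTo-+ n t u)) (+-interchange (sumTo n t) (sumTo n u) (t (suc n)) (u (suc n)))
  where
  +-interchange : ∀ a b c d → (a + b) + (c + d) ≡ (a + c) + (b + d)
  +-interchange = solve-∀

sumTo-*ˡ : ∀ n c (t : ℕ → ℤ) → sumTo n (λ i → c * t i) ≡ c * sumTo n t
sumTo-*ˡ zero    c t = refl
sumTo-*ˡ (suc n) c t = trans (cong (_+ c * t (suc n)) (sumTo-*ˡ n c t)) (sym (ℤP.*-distribˡ-+ c (sumTo n t) (t (suc n))))

sumTo-*ʳ : ∀ n c (t : ℕ → ℤ) → sumTo n (λ i → t i * c) ≡ sumTo n t * c
sumTo-*ʳ n c t = trans (sumTo-cong n (λ i _ → ℤP.*-comm (t i) c)) (trans (sumTo-*ˡ n c t) (ℤP.*-comm c _))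

sumTo-neg : ∀ n (t : ℕ → ℤ) → sumTo n (λ i → - t i) ≡ - sumTo n t
sumTo-neg zero    t = refl
sumTo-neg (suc n) t = trans (cong (_+ - t (suc n)) (sumTo-neg n t)) (sym (ℤP.neg-distrib-+ (sumTo n t) (t (suc n))))

sumTo-- : ∀ n (t u : ℕ → ℤ) → sumTo n (λ i → t i - u i) ≡ sumTo n t - sumTo n u
sumTo-- n t u = trans (sumTo-+ n t (λ i → - u i)) (cong (λ s → sumTo n t + s) (sumTo-neg n u))

sumTo-extend : ∀ n N (t : ℕ → ℤ) → n ≤ N → (∀ i → n < i → i ≤ N → t i ≡ 0ℤ) → sumTo N t ≡ sumTo n t
sumTo-extend n zero    t z≤n z = refl
sumTo-extend n (suc N) t n≤N z with ℕP.m≤n⇒m<n∨m≡n n≤N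
... | inj₂ refl = refl
... | inj₁ n<1+N = begin
    sumTo N t + t (suc N)
  ≡⟨ cong₂ _+_ (sumTo-extend n N t (ℕP.≤-pred n<1+N) (λ i n<i i≤N → z i n<i (ℕP.m≤n⇒m≤1+n i≤N))) (z (suc N) n<1+N ℕP.≤-refl) ⟩
    sumTo n t + 0ℤ
  ≡⟨ ℤP.+-identityʳ _ ⟩
    sumTo n t ∎

sumTo-single : ∀ n m (t : ℕ → ℤ) → m ≤ n → (∀ j → j ≤ n → j ≢ m → t j ≡ 0ℤ) → sumTo n t ≡ t m
sumTo-single zero    .zero t z≤n z = refl
sumTo-single (suc n) m     t m≤n z with ℕP.m≤n⇒m<n∨m≡n m≤n
... | inj₂ refl = trans (cong (_+ t (suc n)) (sumTo-zero n (λ j j≤n → z j (ℕP.m≤n⇒m≤1+n j≤n) (ℕP.<⇒≢ (s≤s j≤n)))))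
                        (ℤP.+-identityˡ _)
... | inj₁ m<1+n = trans (cong₂ _+_ (sumTo-single n m t (ℕP.≤-pred m<1+n) (λ j j≤n → z j (ℕP.m≤n⇒m≤1+n j≤n)))
                                    (z (suc n) ℕP.≤-refl (λ 1+n≡m → ℕP.<⇒≢ m<1+n (sym 1+n≡m))))
                         (ℤP.+-identityʳ _)

sumTo-head : ∀ n (t : ℕ → ℤ) → sumTo (suc n) t ≡ t 0 + sumTo n (λ i → t (suc i))
sumTo-head zero    t = refl
sumTo-head (suc n) t = trans (cong (_+ t (suc (suc n))) (sumTo-head n t)) (ℤP.+-assoc (t 0) _ _)

sumTo-reverse : ∀ n (t : ℕ → ℤ) → sumTo n t ≡ sumTo n (λ i → t (n ∸ i))
sumTo-reverse zero    t = refl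
sumTo-reverse (suc n) t = begin
    sumTo (suc n) t
  ≡⟨ sumTo-head n t ⟩
    t 0 + sumTo n (λ i → t (suc i))
  ≡⟨ cong (λ s → t 0 + s) (sumTo-reverse n (λ i → t (suc i))) ⟩
    t 0 + sumTo n (λ i → t (suc (n ∸ i)))
  ≡⟨ ℤP.+-comm (t 0) _ ⟩
    sumTo n (λ i → t (suc (n ∸ i))) + t 0
  ≡⟨ cong₂ _+_ (sumTo-cong n (λ i i≤n → cong t (sym (ℕP.+-∸-assoc 1 i≤n)))) (cong t (sym (ℕP.n∸n≡0 n))) ⟩
    sumTo n (λ i → t (suc n ∸ i)) + t (suc n ∸ suc n) ∎

sumTo-swap : ∀ n m (T : ℕ → ℕ → ℤ) → sumTo n (λ i → sumTo m (T i)) ≡ sumTo m (λ j → sumTo n (λ i → T i j))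
sumTo-swap zero    m T = refl
sumTo-swap (suc n) m T = trans (cong (_+ sumTo m (T (suc n))) (sumTo-swap n m T))
                               (sym (sumTo-+ m (λ j → sumTo n (λ i → T i j)) (T (suc n))))

sumTo-triangle : ∀ N (T : ℕ → ℕ → ℤ) →
  sumTo N (λ k → sumTo k (λ i → T i (k ∸ i))) ≡ sumTo N (λ i → sumTo (N ∸ i) (T i))
sumTo-triangle zero    T = refl
sumTo-triangle (suc N) T = begin
    sumTo N (λ k → sumTo k (λ i → T i (k ∸ i))) + sumTo (suc N) (λ i → T i (suc N ∸ i))
  ≡⟨ cong (_+ sumTo (suc N) (λ i → T i (suc N ∸ i))) (sumTo-triangle N T) ⟩
    Previous + (Antidiagonal + T (suc N) (suc N ∸ suc N))
  ≡⟨ cong (λ m → Previous + (Antidiagonal + T (suc N) m)) (ℕP.n∸n≡0 N) ⟩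
    Previous + (Antidiagonal + T (suc N) 0)
  ≡⟨ sym (ℤP.+-assoc Previous Antidiagonal _) ⟩
    (Previous + Antidiagonal) + T (suc N) 0
  ≡⟨ cong (_+ T (suc N) 0) (sym (sumTo-+ N (λ i → sumTo (N ∸ i) (T i)) (λ i → T i (suc N ∸ i)))) ⟩
    sumTo N (λ i → sumTo (N ∸ i) (T i) + T i (suc N ∸ i)) + T (suc N) 0
  ≡⟨ cong (_+ T (suc N) 0) (sumTo-cong N (λ i i≤N → cong (λ m → sumTo (N ∸ i) (T i) + T i m) (ℕP.+-∸-assoc 1 i≤N))) ⟩
    sumTo N (λ i → sumTo (suc (N ∸ i)) (T i)) + T (suc N) 0
  ≡⟨ cong₂ _+_ (sumTo-cong N (λ i i≤N → cong (λ m → sumTo m (T i)) (sym (ℕP.+-∸-assoc 1 i≤N))))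
               (cong (λ m → sumTo m (T (suc N))) (sym (ℕP.n∸n≡0 N))) ⟩
    sumTo (suc N) (λ i → sumTo (suc N ∸ i) (T i)) ∎
  where
  Previous = sumTo N (λ i → sumTo (N ∸ i) (T i))
  Antidiagonal = sumTo N (λ i → T i (suc N ∸ i))

-- Formal power series

infixl 6 _⊕_
_⊕_ : Series → Series → Series
(a ⊕ b) n = a n + b n

⊛-cong : ∀ {a a′ b b′} → a ≈ₛ a′ → b ≈ₛ b′ → (a ⊛ b) ≈ₛ (a′ ⊛ b′)
⊛-cong a≈a′ b≈b′ n = sumTo-cong n (λ i _ → cong₂ _*_ (a≈a′ i) (b≈b′ (n ∸ i)))

⊛-congˡ : ∀ a {b b′} → b ≈ₛ b′ → (a ⊛ b) ≈ₛ (a ⊛ b′)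
⊛-congˡ a {b} {b′} = ⊛-cong {a} {a} {b} {b′} (λ _ → refl)

⊛-congʳ : ∀ b {a a′} → a ≈ₛ a′ → (a ⊛ b) ≈ₛ (a′ ⊛ b)
⊛-congʳ b {a} {a′} a≈a′ = ⊛-cong {a} {a′} {b} {b} a≈a′ (λ _ → refl)

⊛-comm : ∀ a b → (a ⊛ b) ≈ₛ (b ⊛ a)
⊛-comm a b n = trans (sumTo-reverse n _) (sumTo-cong n (λ i i≤n →
  trans (cong (λ m → a (n ∸ i) * b m) (ℕP.m∸[m∸n]≡n i≤n)) (ℤP.*-comm (a (n ∸ i)) (b i))))

⊛-assoc : ∀ a b c → ((a ⊛ b) ⊛ c) ≈ₛ (a ⊛ (b ⊛ c))
⊛-assoc a b c n = begin
    sumTo n (λ k → sumTo k (λ i → a i * b (k ∸ i)) * c (n ∸ k))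
  ≡⟨ sumTo-cong n (λ k _ → sym (sumTo-*ʳ k _ _)) ⟩
    sumTo n (λ k → sumTo k (λ i → a i * b (k ∸ i) * c (n ∸ k)))
  ≡⟨ sumTo-cong n (λ k _ → sumTo-cong k (λ i i≤k →
       cong (λ m → a i * b (k ∸ i) * c (n ∸ m)) (sym (ℕP.m+[n∸m]≡n i≤k)))) ⟩
    sumTo n (λ k → sumTo k (λ i → T i (k ∸ i)))
  ≡⟨ sumTo-triangle n T ⟩
    sumTo n (λ i → sumTo (n ∸ i) (T i))
  ≡⟨ sumTo-cong n (λ i _ → sumTo-cong (n ∸ i) (λ j _ →
       trans (ℤP.*-assoc (a i) (b j) _) (cong (λ m → a i * (b j * c m)) (sym (ℕP.∸-+-assoc n i j))))) ⟩
    sumTo n (λ i → sumTo (n ∸ i) (λ j → a i * (b j * c (n ∸ i ∸ j))))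
  ≡⟨ sumTo-cong n (λ i _ → sumTo-*ˡ (n ∸ i) (a i) _) ⟩
    sumTo n (λ i → a i * (b ⊛ c) (n ∸ i)) ∎
  where
  T : ℕ → ℕ → ℤ
  T i j = a i * b j * c (n ∸ (i +ℕ j))

⊛-identityˡ : ∀ a → (one ⊛ a) ≈ₛ a
⊛-identityˡ a n = trans (sumTo-single n 0 _ z≤n (λ { zero _ 0≢0 → ⊥-elim (0≢0 refl) ; (suc j) _ _ → refl }))
                        (ℤP.*-identityˡ (a n))

⊛-identityʳ : ∀ a → (a ⊛ one) ≈ₛ a
⊛-identityʳ a n = trans (⊛-comm a one n) (⊛-identityˡ a n)

⊛-distribʳ-⊕ : ∀ c a b → ((a ⊕ b) ⊛ c) ≈ₛ (a ⊛ c ⊕ b ⊛ c)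
⊛-distribʳ-⊕ c a b n = trans (sumTo-cong n (λ i _ → ℤP.*-distribʳ-+ (c (n ∸ i)) (a i) (b i))) (sumTo-+ n _ _)

⊛-commutativeMonoid : CommutativeMonoid _ _
⊛-commutativeMonoid = record
  { Carrier = Series
  ; _≈_ = _≈ₛ_
  ; _∙_ = _⊛_
  ; ε = one
  ; isCommutativeMonoid = record
    { isMonoid = record
      { isSemigroup = record
        { isMagma = record
          { isEquivalence = record
            { refl = λ _ → refl ; sym = λ e n → sym (e n) ; trans = λ e e′ n → trans (e n) (e′ n) }
          ; ∙-cong = ⊛-cong }
        ; assoc = ⊛-assoc }
      ; identity = ⊛-identityˡ , ⊛-identityʳ }
    ; comm = ⊛-comm } }

open CommutativeMonoid ⊛-commutativeMonoid using () renaming (sym to ≈ₛ-sym; trans to ≈ₛ-trans)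
open import Algebra.Properties.CommutativeSemigroup (CommutativeMonoid.commutativeSemigroup ⊛-commutativeMonoid)
  using (interchange; x∙yz≈y∙xz)

⊛-vanishes-below : ∀ a b n → (∀ i → i ≤ n → a i ≡ 0ℤ) → (a ⊛ b) n ≡ 0ℤ
⊛-vanishes-below a b n a≡0 = sumTo-zero n (λ i i≤n → cong (_* b (n ∸ i)) (a≡0 i i≤n))

⊛-at-orders : ∀ a b k l → (∀ i → i < k → a i ≡ 0ℤ) → (∀ i → i < l → b i ≡ 0ℤ) → (a ⊛ b) (k +ℕ l) ≡ a k * b l
⊛-at-orders a b k l a≡0 b≡0 =
  trans (sumTo-single (k +ℕ l) k _ (ℕP.m≤m+n k l) off-k) (cong (λ m → a k * b m) (ℕP.m+n∸m≡n k l))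
  where
  off-k : ∀ j → j ≤ k +ℕ l → j ≢ k → a j * b (k +ℕ l ∸ j) ≡ 0ℤ
  off-k j j≤ j≢k with ℕP.<-cmp j k
  ... | tri< j<k _ _ = cong (_* b (k +ℕ l ∸ j)) (a≡0 j j<k)
  ... | tri≈ _ j≡k _ = ⊥-elim (j≢k j≡k)
  ... | tri> _ _ k<j = trans (cong (a j *_) (b≡0 _ lt)) (ℤP.*-zeroʳ (a j))
    where
    lt : k +ℕ l ∸ j < l
    lt = ℕP.+-cancelˡ-< j (k +ℕ l ∸ j) l (subst (_< j +ℕ l) (sym (ℕP.m+[n∸m]≡n j≤)) (ℕP.+-monoˡ-< l k<j))

pow-cong : ∀ {a b} k → a ≈ₛ b → pow a k ≈ₛ pow b k
pow-cong zero    a≈b = λ _ → refl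
pow-cong (suc k) a≈b = ⊛-cong a≈b (pow-cong k a≈b)

pow-+ : ∀ a m n → pow a (m +ℕ n) ≈ₛ (pow a m ⊛ pow a n)
pow-+ a zero    n = ≈ₛ-sym (⊛-identityˡ (pow a n))
pow-+ a (suc m) n = ≈ₛ-trans (⊛-congˡ a (pow-+ a m n)) (≈ₛ-sym (⊛-assoc a (pow a m) (pow a n)))

pow-⊛ : ∀ a b k → pow (a ⊛ b) k ≈ₛ (pow a k ⊛ pow b k)
pow-⊛ a b zero    = ≈ₛ-sym (⊛-identityˡ one)
pow-⊛ a b (suc k) = ≈ₛ-trans (⊛-congˡ (a ⊛ b) (pow-⊛ a b k)) (interchange a b (pow a k) (pow b k))

pow-vanishes-below : ∀ a → a 0 ≡ 0ℤ → ∀ k n → n < k → pow a k n ≡ 0ℤ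
pow-vanishes-below a a₀ (suc k) zero    _         = cong (_* pow a k 0) a₀
pow-vanishes-below a a₀ (suc k) (suc n) (s≤s n<k) = begin
    sumTo (suc n) (λ i → a i * pow a k (suc n ∸ i))
  ≡⟨ sumTo-head n _ ⟩
    a 0 * pow a k (suc n) + sumTo n (λ i → a (suc i) * pow a k (n ∸ i))
  ≡⟨ cong₂ _+_ (cong (_* pow a k (suc n)) a₀) (sumTo-zero n (λ i _ →
       trans (cong (a (suc i) *_) (pow-vanishes-below a a₀ k (n ∸ i) (ℕP.≤-<-trans (ℕP.m∸n≤m n i) n<k)))
             (ℤP.*-zeroʳ (a (suc i))))) ⟩
    0ℤ ∎

pow-diagonal : ∀ a → a 0 ≡ 0ℤ → a 1 ≡ 1ℤ → ∀ j → pow a j j ≡ 1ℤ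
pow-diagonal a a₀ a₁ zero    = refl
pow-diagonal a a₀ a₁ (suc j) =
  trans (⊛-at-orders a (pow a j) 1 j (λ { zero _ → a₀ ; (suc i) (s≤s ()) }) (λ i i<j → pow-vanishes-below a a₀ j i i<j))
        (cong₂ _*_ a₁ (pow-diagonal a a₀ a₁ j))

X⊛-suc : ∀ a n → (X ⊛ a) (suc n) ≡ a n
X⊛-suc a n = trans (sumTo-single (suc n) 1 _ (s≤s z≤n) off-1) (ℤP.*-identityˡ (a n))
  where
  off-1 : ∀ j → j ≤ suc n → j ≢ 1 → X j * a (suc n ∸ j) ≡ 0ℤ
  off-1 zero          _ _   = refl
  off-1 (suc zero)    _ 1≢1 = ⊥-elim (1≢1 refl)
  off-1 (suc (suc j)) _ _   = refl

powX-⊛ : ∀ m a p → (pow X m ⊛ a) (m +ℕ p) ≡ a p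
powX-⊛ zero    a p = ⊛-identityˡ a p
powX-⊛ (suc m) a p = trans (⊛-assoc X (pow X m) a (suc (m +ℕ p))) (trans (X⊛-suc (pow X m ⊛ a) (m +ℕ p)) (powX-⊛ m a p))

powX-⊛-shift : ∀ m j a i → (pow X (m +ℕ j) ⊛ a) (m +ℕ i) ≡ (pow X j ⊛ a) i
powX-⊛-shift m j a i = begin
    (pow X (m +ℕ j) ⊛ a) (m +ℕ i)
  ≡⟨ ⊛-congʳ a (pow-+ X m j) (m +ℕ i) ⟩
    ((pow X m ⊛ pow X j) ⊛ a) (m +ℕ i)
  ≡⟨ ⊛-assoc (pow X m) (pow X j) a (m +ℕ i) ⟩
    (pow X m ⊛ (pow X j ⊛ a)) (m +ℕ i)
  ≡⟨ powX-⊛ m (pow X j ⊛ a) i ⟩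
    (pow X j ⊛ a) i ∎

-- Composition

comp-extend : ∀ a φ → φ 0 ≡ 0ℤ → ∀ n N → n ≤ N → comp a φ n ≡ sumTo N (λ k → a k * pow φ k n)
comp-extend a φ φ₀ n N n≤N = sym (sumTo-extend n N _ n≤N (λ k n<k _ →
  trans (cong (a k *_) (pow-vanishes-below φ φ₀ k n n<k)) (ℤP.*-zeroʳ (a k))))

comp-⊛-coeff : ∀ a φ c → φ 0 ≡ 0ℤ → ∀ n → (comp a φ ⊛ c) n ≡ sumTo n (λ k → a k * (pow φ k ⊛ c) n)
comp-⊛-coeff a φ c φ₀ n = begin
    sumTo n (λ i → comp a φ i * c (n ∸ i))
  ≡⟨ sumTo-cong n (λ i i≤n → cong (_* c (n ∸ i)) (comp-extend a φ φ₀ i n i≤n)) ⟩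
    sumTo n (λ i → sumTo n (λ k → a k * pow φ k i) * c (n ∸ i))
  ≡⟨ sumTo-cong n (λ i _ → sym (sumTo-*ʳ n (c (n ∸ i)) _)) ⟩
    sumTo n (λ i → sumTo n (λ k → a k * pow φ k i * c (n ∸ i)))
  ≡⟨ sumTo-swap n n _ ⟩
    sumTo n (λ k → sumTo n (λ i → a k * pow φ k i * c (n ∸ i)))
  ≡⟨ sumTo-cong n (λ k _ → trans (sumTo-cong n (λ i _ → ℤP.*-assoc (a k) _ _)) (sumTo-*ˡ n (a k) _)) ⟩
    sumTo n (λ k → a k * (pow φ k ⊛ c) n) ∎

comp-⊛ : ∀ a b φ → φ 0 ≡ 0ℤ → comp (a ⊛ b) φ ≈ₛ (comp a φ ⊛ comp b φ)
comp-⊛ a b φ φ₀ n = begin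
    sumTo n (λ k → sumTo k (λ i → a i * b (k ∸ i)) * pow φ k n)
  ≡⟨ sumTo-cong n (λ k _ → sym (sumTo-*ʳ k _ _)) ⟩
    sumTo n (λ k → sumTo k (λ i → a i * b (k ∸ i) * pow φ k n))
  ≡⟨ sumTo-cong n (λ k _ → sumTo-cong k (λ i i≤k →
       cong (λ m → a i * b (k ∸ i) * pow φ m n) (sym (ℕP.m+[n∸m]≡n i≤k)))) ⟩
    sumTo n (λ k → sumTo k (λ i → T i (k ∸ i)))
  ≡⟨ sumTo-triangle n T ⟩
    sumTo n (λ i → sumTo (n ∸ i) (T i))
  ≡⟨ sumTo-cong n (λ i _ → trans (sumTo-cong (n ∸ i) (λ j _ → ℤP.*-assoc (a i) (b j) _)) (sumTo-*ˡ (n ∸ i) (a i) _)) ⟩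
    sumTo n (λ i → a i * sumTo (n ∸ i) (λ j → b j * pow φ (i +ℕ j) n))
  ≡⟨ sumTo-cong n (λ i _ → cong (a i *_) (sym (sumTo-extend (n ∸ i) n _ (ℕP.m∸n≤m n i) (λ j n∸i<j _ →
       trans (cong (b j *_) (pow-vanishes-below φ φ₀ (i +ℕ j) n (beyond n∸i<j))) (ℤP.*-zeroʳ (b j)))))) ⟩
    sumTo n (λ i → a i * sumTo n (λ j → b j * pow φ (i +ℕ j) n))
  ≡⟨ sumTo-cong n (λ i _ → cong (a i *_) (sumTo-cong n (λ j _ →
       cong (b j *_) (trans (pow-+ φ i j n) (⊛-comm (pow φ i) (pow φ j) n))))) ⟩
    sumTo n (λ i → a i * sumTo n (λ j → b j * (pow φ j ⊛ pow φ i) n))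
  ≡⟨ sumTo-cong n (λ i _ → cong (a i *_) (trans (sym (comp-⊛-coeff b φ (pow φ i) φ₀ n)) (⊛-comm (comp b φ) (pow φ i) n))) ⟩
    sumTo n (λ i → a i * (pow φ i ⊛ comp b φ) n)
  ≡⟨ sym (comp-⊛-coeff a φ (comp b φ) φ₀ n) ⟩
    (comp a φ ⊛ comp b φ) n ∎
  where
  T : ℕ → ℕ → ℤ
  T i j = a i * b j * pow φ (i +ℕ j) n
  beyond : ∀ {i j} → n ∸ i < j → n < i +ℕ j
  beyond {i} n∸i<j = ℕP.≤-<-trans (ℕP.m≤n+m∸n n i) (ℕP.+-monoʳ-< i n∸i<j)

comp-one : ∀ φ → comp one φ ≈ₛ one
comp-one φ n = trans (sumTo-single n 0 _ z≤n (λ { zero _ 0≢0 → ⊥-elim (0≢0 refl) ; (suc j) _ _ → refl }))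
                     (ℤP.*-identityˡ (one n))

comp-pow : ∀ a φ → φ 0 ≡ 0ℤ → ∀ k → comp (pow a k) φ ≈ₛ pow (comp a φ) k
comp-pow a φ φ₀ zero    = comp-one φ
comp-pow a φ φ₀ (suc k) = ≈ₛ-trans (comp-⊛ a (pow a k) φ φ₀) (⊛-congˡ (comp a φ) (comp-pow a φ φ₀ k))

-- The formal derivative

deriv-cong : ∀ {a b} → a ≈ₛ b → deriv a ≈ₛ deriv b
deriv-cong a≈b n = cong (+ suc n *_) (a≈b (suc n))

deriv-X : deriv X ≈ₛ one
deriv-X zero    = refl
deriv-X (suc n) = ℤP.*-zeroʳ (+ suc (suc n))

leibniz : ∀ a b → deriv (a ⊛ b) ≈ₛ (deriv a ⊛ b ⊕ a ⊛ deriv b)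
leibniz a b n = begin
    + suc n * sumTo (suc n) (λ i → a i * b (suc n ∸ i))
  ≡⟨ sym (sumTo-*ˡ (suc n) (+ suc n) _) ⟩
    sumTo (suc n) (λ i → + suc n * (a i * b (suc n ∸ i)))
  ≡⟨ sumTo-cong (suc n) (λ i i≤ → split-weight i (a i) (b (suc n ∸ i)) i≤) ⟩
    sumTo (suc n) (λ i → (+ i * a i) * b (suc n ∸ i) + a i * (+ (suc n ∸ i) * b (suc n ∸ i)))
  ≡⟨ sumTo-+ (suc n) _ _ ⟩
    sumTo (suc n) (λ i → (+ i * a i) * b (suc n ∸ i)) + sumTo (suc n) (λ i → a i * (+ (suc n ∸ i) * b (suc n ∸ i)))
  ≡⟨ cong₂ _+_ (trans (sumTo-head n (λ i → (+ i * a i) * b (suc n ∸ i))) (ℤP.+-identityˡ (sumTo n (λ i → deriv a i * b (n ∸ i))))) last-term-vanishes ⟩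
    (deriv a ⊛ b) n + (a ⊛ deriv b) n ∎
  where
  split-weight : ∀ i x y → i ≤ suc n → + suc n * (x * y) ≡ (+ i * x) * y + x * (+ (suc n ∸ i) * y)
  split-weight i x y i≤ = begin
      + suc n * (x * y)
    ≡⟨ cong (λ m → + m * (x * y)) (sym (ℕP.m+[n∸m]≡n i≤)) ⟩
      + (i +ℕ (suc n ∸ i)) * (x * y)
    ≡⟨ cong (_* (x * y)) (ℤP.pos-+ i (suc n ∸ i)) ⟩
      (+ i + + (suc n ∸ i)) * (x * y)
    ≡⟨ distribute (+ i) (+ (suc n ∸ i)) x y ⟩
      (+ i * x) * y + x * (+ (suc n ∸ i) * y) ∎
    where
    distribute : ∀ p q x y → (p + q) * (x * y) ≡ (p * x) * y + x * (q * y)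
    distribute = solve-∀
  last-term-vanishes : sumTo (suc n) (λ i → a i * (+ (suc n ∸ i) * b (suc n ∸ i))) ≡ (a ⊛ deriv b) n
  last-term-vanishes = begin
      sumTo n (λ i → a i * (+ (suc n ∸ i) * b (suc n ∸ i))) + a (suc n) * (+ (suc n ∸ suc n) * b (suc n ∸ suc n))
    ≡⟨ cong (λ s → sumTo n (λ i → a i * (+ (suc n ∸ i) * b (suc n ∸ i))) + s)
            (trans (cong (λ m → a (suc n) * (+ m * b m)) (ℕP.n∸n≡0 n)) (ℤP.*-zeroʳ (a (suc n)))) ⟩
      sumTo n (λ i → a i * (+ (suc n ∸ i) * b (suc n ∸ i))) + 0ℤ
    ≡⟨ ℤP.+-identityʳ _ ⟩
      sumTo n (λ i → a i * (+ (suc n ∸ i) * b (suc n ∸ i)))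
    ≡⟨ sumTo-cong n (λ i i≤n → cong (λ m → a i * (+ m * b m)) (ℕP.+-∸-assoc 1 i≤n)) ⟩
      (a ⊛ deriv b) n ∎

infixl 7 _·_
_·_ : ℤ → Series → Series
(c · a) n = c * a n

deriv-pow : ∀ a k → deriv (pow a (suc k)) ≈ₛ (+ suc k · (pow a k ⊛ deriv a))
deriv-pow a zero n = begin
    deriv (a ⊛ one) n
  ≡⟨ deriv-cong (⊛-identityʳ a) n ⟩
    deriv a n
  ≡⟨ sym (trans (ℤP.*-identityˡ _) (⊛-identityˡ (deriv a) n)) ⟩
    (+ 1 · (one ⊛ deriv a)) n ∎
deriv-pow a (suc k) n = begin
    deriv (a ⊛ pow a (suc k)) n
  ≡⟨ leibniz a (pow a (suc k)) n ⟩
    (deriv a ⊛ pow a (suc k)) n + (a ⊛ deriv (pow a (suc k))) n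
  ≡⟨ cong₂ _+_ (⊛-comm (deriv a) (pow a (suc k)) n) (⊛-congˡ a (deriv-pow a k) n) ⟩
    Y + (a ⊛ (+ suc k · (pow a k ⊛ deriv a))) n
  ≡⟨ cong (λ s → Y + s) (trans (sumTo-cong n (λ i _ → x*[c*y]≡c*[x*y] (a i) (+ suc k) _)) (sumTo-*ˡ n (+ suc k) _)) ⟩
    Y + + suc k * (a ⊛ (pow a k ⊛ deriv a)) n
  ≡⟨ cong (λ y → Y + + suc k * y) (sym (⊛-assoc a (pow a k) (deriv a) n)) ⟩
    Y + + suc k * Y
  ≡⟨ y+c*y≡[1+c]*y Y (+ suc k) ⟩
    (1ℤ + + suc k) * Y ∎
  where
  Y = (pow a (suc k) ⊛ deriv a) n
  x*[c*y]≡c*[x*y] : ∀ x c y → x * (c * y) ≡ c * (x * y)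
  x*[c*y]≡c*[x*y] = solve-∀
  y+c*y≡[1+c]*y : ∀ y c → y + c * y ≡ (1ℤ + c) * y
  y+c*y≡[1+c]*y = solve-∀

pow-deriv-coeff : ∀ a q → (pow a q ⊛ deriv a) q ≡ pow a (suc q) (suc q)
pow-deriv-coeff a q = sym (ℤP.*-cancelˡ-≡ (+ suc q) _ _ (deriv-pow a q q))

chain-rule : ∀ a φ → φ 0 ≡ 0ℤ → deriv (comp a φ) ≈ₛ (comp (deriv a) φ ⊛ deriv φ)
chain-rule a φ φ₀ n = begin
    + suc n * comp a φ (suc n)
  ≡⟨ sym (sumTo-*ˡ (suc n) (+ suc n) _) ⟩
    sumTo (suc n) (λ k → + suc n * (a k * pow φ k (suc n)))
  ≡⟨ sumTo-head n _ ⟩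
    + suc n * (a 0 * 0ℤ) + sumTo n (λ k → + suc n * (a (suc k) * pow φ (suc k) (suc n)))
  ≡⟨ cong (_+ sumTo n (λ k → + suc n * (a (suc k) * pow φ (suc k) (suc n)))) (trans (cong (+ suc n *_) (ℤP.*-zeroʳ (a 0))) (ℤP.*-zeroʳ (+ suc n))) ⟩
    0ℤ + sumTo n (λ k → + suc n * (a (suc k) * pow φ (suc k) (suc n)))
  ≡⟨ ℤP.+-identityˡ _ ⟩
    sumTo n (λ k → + suc n * (a (suc k) * pow φ (suc k) (suc n)))
  ≡⟨ sumTo-cong n (λ k _ → trans (c*[x*y]≡x*[c*y] (+ suc n) (a (suc k)) _) (cong (a (suc k) *_) (deriv-pow φ k n))) ⟩
    sumTo n (λ k → a (suc k) * (+ suc k * (pow φ k ⊛ deriv φ) n))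
  ≡⟨ sumTo-cong n (λ k _ → sym ([c*x]*y≡x*[c*y] (+ suc k) (a (suc k)) _)) ⟩
    sumTo n (λ k → deriv a k * (pow φ k ⊛ deriv φ) n)
  ≡⟨ sym (comp-⊛-coeff (deriv a) φ (deriv φ) φ₀ n) ⟩
    (comp (deriv a) φ ⊛ deriv φ) n ∎
  where
  c*[x*y]≡x*[c*y] : ∀ c x y → c * (x * y) ≡ x * (c * y)
  c*[x*y]≡x*[c*y] = solve-∀
  [c*x]*y≡x*[c*y] : ∀ c x y → (c * x) * y ≡ x * (c * y)
  [c*x]*y≡x*[c*y] = solve-∀

comp-coeff-1 : ∀ a φ → comp a φ 1 ≡ a 1 * φ 1
comp-coeff-1 a φ = trans (cong₂ _+_ (ℤP.*-zeroʳ (a 0)) (cong (a 1 *_) (⊛-identityʳ φ 1))) (ℤP.+-identityˡ _)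

-- Riordan arrays

matMul-riordan : ∀ d h (Q : Matrix) → h 0 ≡ 0ℤ → ∀ n k →
  matMul (riordan d h) Q n k ≡ (d ⊛ comp (λ j → Q j k) h) n
matMul-riordan d h Q h₀ n k = begin
    sumTo n (λ j → (d ⊛ pow h j) n * Q j k)
  ≡⟨ sumTo-cong n (λ j _ → trans (ℤP.*-comm _ (Q j k)) (cong (Q j k *_) (⊛-comm d (pow h j) n))) ⟩
    sumTo n (λ j → Q j k * (pow h j ⊛ d) n)
  ≡⟨ sym (comp-⊛-coeff (λ j → Q j k) h d h₀ n) ⟩
    (comp (λ j → Q j k) h ⊛ d) n
  ≡⟨ ⊛-comm (comp (λ j → Q j k) h) d n ⟩
    (d ⊛ comp (λ j → Q j k) h) n ∎

riordan-mul : ∀ d h u w → h 0 ≡ 0ℤ → ∀ n k →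
  matMul (riordan d h) (riordan u w) n k ≡ riordan (d ⊛ comp u h) (comp w h) n k
riordan-mul d h u w h₀ n k = begin
    matMul (riordan d h) (riordan u w) n k
  ≡⟨ matMul-riordan d h (riordan u w) h₀ n k ⟩
    (d ⊛ comp (u ⊛ pow w k) h) n
  ≡⟨ ⊛-congˡ d (≈ₛ-trans (comp-⊛ u (pow w k) h h₀) (⊛-congˡ (comp u h) (comp-pow w h h₀ k))) n ⟩
    (d ⊛ (comp u h ⊛ pow (comp w h) k)) n
  ≡⟨ sym (⊛-assoc d (comp u h) (pow (comp w h) k) n) ⟩
    riordan (d ⊛ comp u h) (comp w h) n k ∎

riordan-diagonal : ∀ d h → h 0 ≡ 0ℤ → h 1 ≡ 1ℤ → d 0 ≡ 1ℤ → ∀ j → riordan d h j j ≡ 1ℤ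
riordan-diagonal d h h₀ h₁ d₀ j = begin
    (d ⊛ pow h j) j
  ≡⟨ ⊛-at-orders d (pow h j) 0 j (λ _ ()) (λ i i<j → pow-vanishes-below h h₀ j i i<j) ⟩
    d 0 * pow h j j
  ≡⟨ cong₂ _*_ d₀ (pow-diagonal h h₀ h₁ j) ⟩
    1ℤ ∎

riordan-above-diagonal : ∀ d h → h 0 ≡ 0ℤ → ∀ {i j} → i < j → riordan d h i j ≡ 0ℤ
riordan-above-diagonal d h h₀ {i} {j} i<j = trans (⊛-comm d (pow h j) i)
  (⊛-vanishes-below (pow h j) d i (λ i′ i′≤i → pow-vanishes-below h h₀ j i′ (ℕP.≤-<-trans i′≤i i<j)))

module _ (M : Matrix) (M-diagonal : ∀ j → M j j ≡ 1ℤ) (M-upper : ∀ {i j} → i < j → M i j ≡ 0ℤ) where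

  unitriangular-cancelˡ : ∀ n (r u : ℕ → ℤ) →
    (∀ j → j ≤ n → sumTo n (λ i → r i * M i j) ≡ sumTo n (λ i → u i * M i j)) →
    ∀ j → j ≤ n → r j ≡ u j
  unitriangular-cancelˡ n r u rM≡uM j j≤n = downward (suc n) j j≤n (ℕP.m≤n+m (suc n) j)
    where
    -- Induction on d runs over the columns from j = n downwards: column j of (r - u) M
    -- is (r j - u j) plus multiples of the r i - u i with i > j, already known to vanish.
    downward : ∀ d j → j ≤ n → n < j +ℕ d → r j ≡ u j
    downward zero    j j≤n n<j+0 = ⊥-elim (ℕP.<⇒≱ n<j+0 (subst (_≤ n) (sym (ℕP.+-identityʳ j)) j≤n))
    downward (suc d) j j≤n n<j+1+d = ℤP.i-j≡0⇒i≡j (r j) (u j) (begin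
        r j - u j
      ≡⟨ sym (ℤP.*-identityʳ (r j - u j)) ⟩
        (r j - u j) * 1ℤ
      ≡⟨ cong ((r j - u j) *_) (sym (M-diagonal j)) ⟩
        (r j - u j) * M j j
      ≡⟨ sym (sumTo-single n j _ j≤n off-diagonal) ⟩
        sumTo n (λ i → (r i - u i) * M i j)
      ≡⟨ sumTo-cong n (λ i _ → [x-y]*z≡x*z-y*z (r i) (u i) (M i j)) ⟩
        sumTo n (λ i → r i * M i j - u i * M i j)
      ≡⟨ sumTo-- n _ _ ⟩
        sumTo n (λ i → r i * M i j) - sumTo n (λ i → u i * M i j)
      ≡⟨ ℤP.i≡j⇒i-j≡0 (rM≡uM j j≤n) ⟩
        0ℤ ∎)
      where
      [x-y]*z≡x*z-y*z : ∀ x y z → (x - y) * z ≡ x * z - y * z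
      [x-y]*z≡x*z-y*z = solve-∀
      off-diagonal : ∀ i → i ≤ n → i ≢ j → (r i - u i) * M i j ≡ 0ℤ
      off-diagonal i i≤n i≢j with ℕP.<-cmp i j
      ... | tri< i<j _ _ = trans (cong ((r i - u i) *_) (M-upper i<j)) (ℤP.*-zeroʳ (r i - u i))
      ... | tri≈ _ i≡j _ = ⊥-elim (i≢j i≡j)
      ... | tri> _ _ j<i = cong (_* M i j) (ℤP.i≡j⇒i-j≡0 (downward d i i≤n n<i+d))
        where
        n<i+d : n < i +ℕ d
        n<i+d = ℕP.<-≤-trans n<j+1+d (subst (_≤ i +ℕ d) (sym (ℕP.+-suc j d)) (ℕP.+-monoˡ-≤ d j<i))

-- Lagrange inversion

module LagrangeInversion (f ψ : Series) (f₀ : f 0 ≡ 1ℤ) (fψ≈X : (f ⊛ ψ) ≈ₛ X) where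

  ψ₀ : ψ 0 ≡ 0ℤ
  ψ₀ = trans (sym (ℤP.*-identityˡ (ψ 0))) (trans (cong (_* ψ 0) (sym f₀)) (fψ≈X 0))

  ψ₁ : ψ 1 ≡ 1ℤ
  ψ₁ = begin
      ψ 1
    ≡⟨ sym (ℤP.*-identityˡ (ψ 1)) ⟩
      1ℤ * ψ 1
    ≡⟨ sym (ℤP.+-identityʳ _) ⟩
      1ℤ * ψ 1 + 0ℤ
    ≡⟨ cong₂ (λ x y → x * ψ 1 + y) (sym f₀) (sym (trans (cong (f 1 *_) ψ₀) (ℤP.*-zeroʳ (f 1)))) ⟩
      f 0 * ψ 1 + f 1 * ψ 0
    ≡⟨ fψ≈X 1 ⟩
      1ℤ ∎

  fψ′+f′ψ≈1 : (f ⊛ deriv ψ ⊕ deriv f ⊛ ψ) ≈ₛ one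
  fψ′+f′ψ≈1 n = begin
      (f ⊛ deriv ψ) n + (deriv f ⊛ ψ) n
    ≡⟨ ℤP.+-comm ((f ⊛ deriv ψ) n) ((deriv f ⊛ ψ) n) ⟩
      (deriv f ⊛ ψ) n + (f ⊛ deriv ψ) n
    ≡⟨ sym (leibniz f ψ n) ⟩
      deriv (f ⊛ ψ) n
    ≡⟨ deriv-cong fψ≈X n ⟩
      deriv X n
    ≡⟨ deriv-X n ⟩
      one n ∎

  -- ψ′ f^(q+2) = f^(q+1) - x f′ f^q, whose coefficient at x^(q+1) vanishes by pow-deriv-coeff.
  ψ′fᵖ⁺¹-coeff : ∀ p → (deriv ψ ⊛ pow f (suc p)) p ≡ one p
  ψ′fᵖ⁺¹-coeff zero    = cong₂ (λ x y → (+ 1 * x) * (y * 1ℤ)) ψ₁ f₀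
  ψ′fᵖ⁺¹-coeff (suc q) = identityˡ-unique _ (G q) (begin
      (deriv ψ ⊛ (f ⊛ F)) (suc q) + G q
    ≡⟨ cong₂ _+_ (≈ₛ-trans (x∙yz≈y∙xz (deriv ψ) f F) (≈ₛ-sym (⊛-assoc f (deriv ψ) F)) (suc q)) G≡f′ψF ⟩
      ((f ⊛ deriv ψ) ⊛ F) (suc q) + ((deriv f ⊛ ψ) ⊛ F) (suc q)
    ≡⟨ sym (⊛-distribʳ-⊕ F (f ⊛ deriv ψ) (deriv f ⊛ ψ) (suc q)) ⟩
      ((f ⊛ deriv ψ ⊕ deriv f ⊛ ψ) ⊛ F) (suc q)
    ≡⟨ ⊛-congʳ F fψ′+f′ψ≈1 (suc q) ⟩
      (one ⊛ F) (suc q)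
    ≡⟨ ⊛-identityˡ F (suc q) ⟩
      F (suc q)
    ≡⟨ sym (pow-deriv-coeff f q) ⟩
      G q ∎)
    where
    F = pow f (suc q)
    G = pow f q ⊛ deriv f
    G≡f′ψF : G q ≡ ((deriv f ⊛ ψ) ⊛ F) (suc q)
    G≡f′ψF = begin
        G q
      ≡⟨ sym (X⊛-suc G q) ⟩
        (X ⊛ G) (suc q)
      ≡⟨ ⊛-cong (≈ₛ-sym (≈ₛ-trans (⊛-comm ψ f) fψ≈X)) (⊛-comm (pow f q) (deriv f)) (suc q) ⟩
        ((ψ ⊛ f) ⊛ (deriv f ⊛ pow f q)) (suc q)
      ≡⟨ interchange ψ f (deriv f) (pow f q) (suc q) ⟩
        ((ψ ⊛ deriv f) ⊛ F) (suc q)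
      ≡⟨ ⊛-congʳ F (⊛-comm ψ (deriv f)) (suc q) ⟩
        ((deriv f ⊛ ψ) ⊛ F) (suc q) ∎

  lagrange-row : ∀ k p → sumTo (k +ℕ p) (λ i → pow f (suc (k +ℕ p)) (k +ℕ p ∸ i) * riordan (deriv ψ) ψ i k)
                         ≡ pow X k (k +ℕ p)
  lagrange-row k p = begin
      sumTo n (λ i → pow f (suc n) (n ∸ i) * riordan (deriv ψ) ψ i k)
    ≡⟨ sumTo-cong n (λ i _ → ℤP.*-comm (pow f (suc n) (n ∸ i)) _) ⟩
      ((deriv ψ ⊛ pow ψ k) ⊛ pow f (suc n)) n
    ≡⟨ ⊛-congˡ (deriv ψ ⊛ pow ψ k) fⁿ⁺¹≈fᵏfᵖ⁺¹ n ⟩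
      ((deriv ψ ⊛ pow ψ k) ⊛ (pow f k ⊛ pow f (suc p))) n
    ≡⟨ ⊛-congʳ (pow f k ⊛ pow f (suc p)) (⊛-comm (deriv ψ) (pow ψ k)) n ⟩
      ((pow ψ k ⊛ deriv ψ) ⊛ (pow f k ⊛ pow f (suc p))) n
    ≡⟨ interchange (pow ψ k) (deriv ψ) (pow f k) (pow f (suc p)) n ⟩
      ((pow ψ k ⊛ pow f k) ⊛ (deriv ψ ⊛ pow f (suc p))) n
    ≡⟨ ⊛-congʳ (deriv ψ ⊛ pow f (suc p)) ψᵏfᵏ≈Xᵏ n ⟩
      (pow X k ⊛ (deriv ψ ⊛ pow f (suc p))) n
    ≡⟨ powX-⊛ k (deriv ψ ⊛ pow f (suc p)) p ⟩
      (deriv ψ ⊛ pow f (suc p)) p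
    ≡⟨ ψ′fᵖ⁺¹-coeff p ⟩
      one p
    ≡⟨ sym (trans (sym (⊛-identityʳ (pow X k) n)) (powX-⊛ k one p)) ⟩
      pow X k n ∎
    where
    n = k +ℕ p
    fⁿ⁺¹≈fᵏfᵖ⁺¹ : pow f (suc n) ≈ₛ (pow f k ⊛ pow f (suc p))
    fⁿ⁺¹≈fᵏfᵖ⁺¹ = ≈ₛ-trans (⊛-congˡ f (pow-+ f k p)) (x∙yz≈y∙xz f (pow f k) (pow f p))
    ψᵏfᵏ≈Xᵏ : (pow ψ k ⊛ pow f k) ≈ₛ pow X k
    ψᵏfᵏ≈Xᵏ = ≈ₛ-trans (≈ₛ-sym (pow-⊛ ψ f k)) (pow-cong k (≈ₛ-trans (⊛-comm ψ f) fψ≈X))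

  module _ (φ : Series) (φ₀ : φ 0 ≡ 0ℤ) (ψ∘φ≈X : comp ψ φ ≈ₛ X) where

    φ₁ : φ 1 ≡ 1ℤ
    φ₁ = begin
        φ 1
      ≡⟨ sym (ℤP.*-identityˡ (φ 1)) ⟩
        1ℤ * φ 1
      ≡⟨ cong (_* φ 1) (sym ψ₁) ⟩
        ψ 1 * φ 1
      ≡⟨ sym (comp-coeff-1 ψ φ) ⟩
        comp ψ φ 1
      ≡⟨ ψ∘φ≈X 1 ⟩
        1ℤ ∎

    riordan-inverse : ∀ n k → matMul (riordan (deriv φ) φ) (riordan (deriv ψ) ψ) n k ≡ pow X k n
    riordan-inverse n k = begin
        matMul (riordan (deriv φ) φ) (riordan (deriv ψ) ψ) n k
      ≡⟨ riordan-mul (deriv φ) φ (deriv ψ) ψ φ₀ n k ⟩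
        ((deriv φ ⊛ comp (deriv ψ) φ) ⊛ pow (comp ψ φ) k) n
      ≡⟨ ⊛-cong φ′·ψ′∘φ≈1 (pow-cong k ψ∘φ≈X) n ⟩
        (one ⊛ pow X k) n
      ≡⟨ ⊛-identityˡ (pow X k) n ⟩
        pow X k n ∎
      where
      φ′·ψ′∘φ≈1 : (deriv φ ⊛ comp (deriv ψ) φ) ≈ₛ one
      φ′·ψ′∘φ≈1 = ≈ₛ-trans (⊛-comm (deriv φ) (comp (deriv ψ) φ))
                    (≈ₛ-trans (≈ₛ-sym (chain-rule ψ φ φ₀)) (≈ₛ-trans (deriv-cong ψ∘φ≈X) deriv-X))

    -- Both sides are rows of left inverses of the unitriangular array (ψ′, ψ).
    lagrange-inversion : ∀ n j → j ≤ n → riordan (deriv φ) φ n j ≡ pow f (suc n) (n ∸ j)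
    lagrange-inversion n =
      unitriangular-cancelˡ (riordan (deriv ψ) ψ) (riordan-diagonal (deriv ψ) ψ ψ₀ ψ₁ (cong (+ 1 *_) ψ₁))
        (riordan-above-diagonal (deriv ψ) ψ ψ₀) n (riordan (deriv φ) φ n) (λ i → pow f (suc n) (n ∸ i))
        (λ j j≤n → trans (riordan-inverse n j) (sym (row j j≤n)))
      where
      row : ∀ j → j ≤ n → sumTo n (λ i → pow f (suc n) (n ∸ i) * riordan (deriv ψ) ψ i j) ≡ pow X j n
      row j j≤n = subst (λ m → sumTo m (λ i → pow f (suc m) (m ∸ i) * riordan (deriv ψ) ψ i j) ≡ pow X j m)
                        (ℕP.m+[n∸m]≡n j≤n) (lagrange-row j (n ∸ j))

    lagrange-bürmann : ∀ b n → (deriv φ ⊛ comp b φ) n ≡ (b ⊛ pow f (suc n)) n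
    lagrange-bürmann b n = begin
        (deriv φ ⊛ comp b φ) n
      ≡⟨ sym (matMul-riordan (deriv φ) φ (λ j _ → b j) φ₀ n 0) ⟩
        sumTo n (λ j → riordan (deriv φ) φ n j * b j)
      ≡⟨ sumTo-cong n (λ j j≤n → trans (cong (_* b j) (lagrange-inversion n j j≤n)) (ℤP.*-comm _ (b j))) ⟩
        (b ⊛ pow f (suc n)) n ∎

-- The array c(A; 2)

c2-coeff : ∀ g f n k → c2 (riordan g (X ⊛ f)) n k ≡ ((g ⊛ pow (X ⊛ f) k) ⊛ pow f (suc n)) n
c2-coeff g f n k = begin
    (g ⊛ pow (X ⊛ f) (suc n +ℕ k)) (suc (2 *ℕ n))
  ≡⟨ cong (λ m → (g ⊛ pow (X ⊛ f) (suc n +ℕ k)) (suc (n +ℕ m))) (ℕP.+-identityʳ n) ⟩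
    (g ⊛ pow (X ⊛ f) (suc n +ℕ k)) (suc n +ℕ n)
  ≡⟨ column (suc n +ℕ k) (suc n +ℕ n) ⟩
    (pow X (suc n +ℕ k) ⊛ (g ⊛ pow f (suc n +ℕ k))) (suc n +ℕ n)
  ≡⟨ powX-⊛-shift (suc n) k (g ⊛ pow f (suc n +ℕ k)) n ⟩
    (pow X k ⊛ (g ⊛ pow f (suc n +ℕ k))) n
  ≡⟨ ⊛-congˡ (pow X k) (⊛-congˡ g fⁿ⁺¹⁺ᵏ≈fᵏfⁿ⁺¹) n ⟩
    (pow X k ⊛ (g ⊛ (pow f k ⊛ pow f (suc n)))) n
  ≡⟨ ⊛-congˡ (pow X k) (≈ₛ-sym (⊛-assoc g (pow f k) (pow f (suc n)))) n ⟩
    (pow X k ⊛ ((g ⊛ pow f k) ⊛ pow f (suc n))) n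
  ≡⟨ sym (⊛-assoc (pow X k) (g ⊛ pow f k) (pow f (suc n)) n) ⟩
    ((pow X k ⊛ (g ⊛ pow f k)) ⊛ pow f (suc n)) n
  ≡⟨ ⊛-congʳ (pow f (suc n)) (≈ₛ-sym (column k)) n ⟩
    ((g ⊛ pow (X ⊛ f) k) ⊛ pow f (suc n)) n ∎
  where
  column : ∀ m → (g ⊛ pow (X ⊛ f) m) ≈ₛ (pow X m ⊛ (g ⊛ pow f m))
  column m = ≈ₛ-trans (⊛-congˡ g (pow-⊛ X f m)) (x∙yz≈y∙xz g (pow X m) (pow f m))
  fⁿ⁺¹⁺ᵏ≈fᵏfⁿ⁺¹ : pow f (suc n +ℕ k) ≈ₛ (pow f k ⊛ pow f (suc n))
  fⁿ⁺¹⁺ᵏ≈fᵏfⁿ⁺¹ i = trans (cong (λ m → pow f m i) (ℕP.+-comm (suc n) k)) (pow-+ f k (suc n) i)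

≡1⇒≢0 : ∀ {x} → x ≡ 1ℤ → x ≢ 0ℤ
≡1⇒≢0 refl ()

mainTheorem7 : (g f : Series) → g 0 ≡ 1ℤ → f 0 ≡ 1ℤ →
    (ψ : Series) → (f ⊛ ψ) ≈ₛ X →
    (φ : Series) → φ 0 ≡ 0ℤ → comp ψ φ ≈ₛ X →
    IsRiordanArray (c2 (riordan g (X ⊛ f)))
    × (∀ n k → c2 (riordan g (X ⊛ f)) n k ≡ matMul (riordan (deriv φ) φ) (riordan g (X ⊛ f)) n k)
mainTheorem7 g f g₀ f₀ ψ fψ≈X φ φ₀ ψ∘φ≈X =
  (deriv φ ⊛ comp g φ , comp (X ⊛ f) φ , (≡1⇒≢0 d₀≡1 , h₀≡0 , ≡1⇒≢0 h₁≡1) , c2≡riordan) , c2≡product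
  where
  open LagrangeInversion f ψ f₀ fψ≈X
  A = riordan g (X ⊛ f)

  c2≡product : ∀ n k → c2 A n k ≡ matMul (riordan (deriv φ) φ) A n k
  c2≡product n k = begin
      c2 A n k
    ≡⟨ c2-coeff g f n k ⟩
      ((g ⊛ pow (X ⊛ f) k) ⊛ pow f (suc n)) n
    ≡⟨ sym (lagrange-bürmann φ φ₀ ψ∘φ≈X (g ⊛ pow (X ⊛ f) k) n) ⟩
      (deriv φ ⊛ comp (g ⊛ pow (X ⊛ f) k) φ) n
    ≡⟨ sym (matMul-riordan (deriv φ) φ A φ₀ n k) ⟩
      matMul (riordan (deriv φ) φ) A n k ∎

  c2≡riordan : ∀ n k → c2 A n k ≡ riordan (deriv φ ⊛ comp g φ) (comp (X ⊛ f) φ) n k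
  c2≡riordan n k = trans (c2≡product n k) (riordan-mul (deriv φ) φ g (X ⊛ f) φ₀ n k)

  d₀≡1 : (deriv φ ⊛ comp g φ) 0 ≡ 1ℤ
  d₀≡1 = cong₂ (λ x y → (+ 1 * x) * (y * 1ℤ)) (φ₁ φ φ₀ ψ∘φ≈X) g₀

  h₀≡0 : comp (X ⊛ f) φ 0 ≡ 0ℤ
  h₀≡0 = refl

  h₁≡1 : comp (X ⊛ f) φ 1 ≡ 1ℤ
  h₁≡1 = trans (comp-coeff-1 (X ⊛ f) φ) (cong₂ _*_ (trans (X⊛-suc f 0) f₀) (φ₁ φ φ₀ ψ∘φ≈X))
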